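{- Let $p\ge1$ be an integer, let $T$ be a tree with at least $p$ vertices and let $H$ be a connected graph with at least $2p$ vertices. Let $V_1,V_2$ be a partition of $V(T(H))$ with $|V_1|\ge p^2$ and $|V_2|\ge p^2$. Then $T(H)$ has a matching of size $p$ each of whose edges has one end in $V_1$ and the other in $V_2$.
   Context: For a tree $T$ and a graph $H$, $T(H)$ is the graph consisting of disjoint copies $H_t$ of $H$, one for each $t\in V(T)$, where for every edge $\{t_1,t_2\}$ of $T$ and every $u\in V(H)$ the copy of $u$ in $H_{t_1}$ is joined to the copy of $u$ in $H_{t_2}$. -}

module Defs where

open import Data.Nat using (ℕ; suc; _≤_; _*_)
open import Data.Fin using (Fin)
open import Data.Product using (_×_; _,_; proj₁; proj₂; Σ; ∃)
open import Data.Sum using (_⊎_; inj₁; inj₂; [_,_])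
open import Data.List using (List; []; _∷_; length; last)
open import Data.List.Relation.Unary.All using (All)
open import Data.List.Relation.Unary.Unique.Propositional using (Unique)
open import Data.Maybe using (Maybe; just; nothing)
open import Relation.Binary.PropositionalEquality using (_≡_)
open import Relation.Nullary using (¬_)
open import Function.Definitions using (Injective)
open import Level using (0ℓ)

record Graph (n : ℕ) : Set₁ where
  field
    Adj     : Fin n → Fin n → Set
    sym     : ∀ {u v} → Adj u v → Adj v u
    irrefl  : ∀ {u} → ¬ Adj u u
open Graph public

module _ {V : Set} (Adj : V → V → Set) where
  data Chain : List V → Set where
    []  : Chain []
    [-] : ∀ {x} → Chain (x ∷ [])
    _∷_ : ∀ {x y xs} → Adj x y → Chain (y ∷ xs) → Chain (x ∷ y ∷ xs)

module _ {n : ℕ} (G : Graph n) where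
  Walk : Fin n → Fin n → Set
  Walk u v = Σ (List (Fin n)) λ ws →
    Chain (Adj G) (u ∷ ws) × last (u ∷ ws) ≡ just v

  Connected : Set
  Connected = ∀ u v → Walk u v

  -- a cycle: distinct vertices v₀ … vₖ (k ≥ 2, i.e. at least 3 vertices),
  -- consecutive ones adjacent, and vₖ adjacent to v₀
  Cycle : Set
  Cycle = Σ (Fin n) λ v₀ → Σ (Fin n) λ v₁ → Σ (List (Fin n)) λ rest →
    let vs = v₀ ∷ v₁ ∷ rest in
    Unique vs × Chain (Adj G) vs × 1 ≤ length rest ×
    (∀ vk → last vs ≡ just vk → Adj G vk v₀)

  Acyclic : Set
  Acyclic = ¬ Cycle

IsTree : ∀ {m} → Graph m → Set
IsTree {m} T = 1 ≤ m × Connected T × Acyclic T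

-- Vertex set of T(H): pairs (t , u), the copy of u in H_t.
-- (t₁,u₁) ~ (t₂,u₂) iff (t₁ = t₂ and u₁u₂ ∈ E(H)) or (t₁t₂ ∈ E(T) and u₁ = u₂).
TH-Adj : ∀ {m n} → Graph m → Graph n → (Fin m × Fin n) → (Fin m × Fin n) → Set
TH-Adj T H (t₁ , u₁) (t₂ , u₂) = (t₁ ≡ t₂ × Adj H u₁ u₂) ⊎ (Adj T t₁ t₂ × u₁ ≡ u₂)

AtLeast : {V : Set} → (V → Set) → ℕ → Set
AtLeast {V} S k = Σ (List V) λ xs → Unique xs × All S xs × k ≤ length xs

-- A matching of size p in the graph with adjacency Adj, each edge a i – b i
-- having a i ∈ V₁ and b i ∈ V₂; all 2p endpoints are pairwise distinct.
CrossMatching : {V : Set} → (V → V → Set) → (V₁ V₂ : V → Set) → ℕ → Set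
CrossMatching {V} Adj V₁ V₂ p =
  Σ (Fin p → V) λ a → Σ (Fin p → V) λ b →
    (∀ i → Adj (a i) (b i)) × (∀ i → V₁ (a i)) × (∀ i → V₂ (b i)) ×
    Injective _≡_ _≡_ [ a , b ]

-- View T(H) as a grid whose rows are the copies H_t and whose columns are the fibres
-- {(t , u) : t ∈ T}; a line is bichromatic if it meets both V₁ and V₂. Rows and columns are
-- connected, so a bichromatic line contains a V₁–V₂ edge, and edges in distinct rows (or in distinct
-- columns) are vertex-disjoint: p bichromatic rows or p bichromatic columns give the matching.
-- Otherwise, as p ≤ |T| and p ≤ |H|, some row t* and some column u* are monochromatic; every vertex
-- coloured unlike (t* , u*) then lies in a bichromatic row and a bichromatic column, so that colour
-- class has fewer than p · p vertices.
module Submission where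

open import Defs
open import Data.Nat using (ℕ; _≤_; _*_)
open import Data.Fin using (Fin)
open import Data.Product using (_×_)
open import Data.Sum using (_⊎_)
open import Relation.Nullary using (¬_)

open import Data.Nat using (_<_; _+_)
open import Data.Nat.Properties using (_≤?_; ≤-trans; <-≤-trans; ≤-<-trans; <-irrefl; <⇒≱; m≤m+n; ≰⇒>; *-mono-<)
open import Data.Fin using (inject≤)
open import Data.Fin.Properties using (inject≤-injective; any?; all?; ¬∀⟶∃¬; pigeonhole; <⇒≢)
open import Data.Product using (Σ; ∃; ∃₂; _,_; proj₁; proj₂; swap)
open import Data.Sum using (inj₁; inj₂; [_,_])
open import Data.List using (List; []; _∷_; length; last; map; _++_; filter; allFin; lookup; cartesianProduct)
open import Data.List.Properties using (length-++; length-map; length-tabulate)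
import Data.List.Relation.Unary.All as All
open import Data.List.Relation.Unary.AllPairs using (_∷_)
open import Data.List.Relation.Unary.Any using (index)
open import Data.List.Relation.Unary.Any.Properties using (lookup-index)
open import Data.List.Relation.Unary.Unique.Propositional using (Unique)
open import Data.List.Relation.Unary.Unique.Propositional.Properties using (filter⁺; allFin⁺)
open import Data.List.Membership.Propositional using (_∈_)
open import Data.List.Membership.Propositional.Properties
  using (∈-lookup; ∈-filter⁺; ∈-filter⁻; ∈-allFin; ∈-cartesianProduct⁺)
open import Data.Maybe using (just)
open import Data.Empty using (⊥; ⊥-elim)
open import Relation.Nullary using (Dec; yes; no; contradiction)
open import Relation.Nullary.Decidable using (_×-dec_)
open import Relation.Unary using (Decidable)
open import Relation.Binary.PropositionalEquality as ≡ using (_≡_; refl; trans; cong; cong₂; subst)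
open import Function using (_∘_; id)
open import Function.Definitions using (Injective)

lookup-injective : ∀ {A : Set} {xs : List A} → Unique xs → Injective _≡_ _≡_ (lookup xs)
lookup-injective {xs = _ ∷ _} _ {Fin.zero} {Fin.zero} _ = refl
lookup-injective {xs = _ ∷ _} (x∉ ∷ _) {Fin.zero} {Fin.suc j} eq = ⊥-elim (All.lookup x∉ (∈-lookup j) eq)
lookup-injective {xs = _ ∷ _} (x∉ ∷ _) {Fin.suc i} {Fin.zero} eq = ⊥-elim (All.lookup x∉ (∈-lookup i) (≡.sym eq))
lookup-injective {xs = _ ∷ _} (_ ∷ u) {Fin.suc i} {Fin.suc j} eq = cong Fin.suc (lookup-injective u eq)

Unique⇒length≤ : ∀ {A : Set} {xs ys : List A} → Unique xs → (∀ {x} → x ∈ xs → x ∈ ys) →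
  length xs ≤ length ys
Unique⇒length≤ {xs = xs} {ys} u xs⊆ys with length xs ≤? length ys
... | yes xs≤ys = xs≤ys
... | no xs≰ys =
  let (i , j , i<j , same-position) = pigeonhole (≰⇒> xs≰ys) position
  in contradiction (lookup-injective u (positions-agree same-position)) (<⇒≢ i<j)
  where
  position : Fin (length xs) → Fin (length ys)
  position i = index (xs⊆ys (∈-lookup {xs = xs} i))
  positions-agree : ∀ {i j} → position i ≡ position j → lookup xs i ≡ lookup xs j
  positions-agree {i} {j} eq = trans (lookup-index (xs⊆ys (∈-lookup {xs = xs} i)))
    (trans (cong (lookup ys) eq) (≡.sym (lookup-index (xs⊆ys (∈-lookup {xs = xs} j)))))

AtLeast⇒≤length : ∀ {A : Set} {S : A → Set} {k} {ys : List A} → AtLeast S k →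
  (∀ {x} → S x → x ∈ ys) → k ≤ length ys
AtLeast⇒≤length (xs , u , xs⊆S , k≤xs) S⊆ys = ≤-trans k≤xs (Unique⇒length≤ u (S⊆ys ∘ All.lookup xs⊆S))

length-cartesianProduct : ∀ {A B : Set} (xs : List A) (ys : List B) →
  length (cartesianProduct xs ys) ≡ length xs * length ys
length-cartesianProduct [] ys = refl
length-cartesianProduct (x ∷ xs) ys = begin
  length (map (x ,_) ys ++ cartesianProduct xs ys)     ≡⟨ length-++ (map (x ,_) ys) ⟩
  length (map (x ,_) ys) + length (cartesianProduct xs ys)
    ≡⟨ cong₂ _+_ (length-map (x ,_) ys) (length-cartesianProduct xs ys) ⟩
  length ys + length xs * length ys                     ∎
  where open ≡.≡-Reasoning

Unique⇒injective-selection : ∀ {A : Set} {xs : List A} {p} → Unique xs → p ≤ length xs →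
  Σ (Fin p → A) λ f → Injective _≡_ _≡_ f × (∀ i → f i ∈ xs)
Unique⇒injective-selection {xs = xs} u p≤xs =
  lookup xs ∘ (λ i → inject≤ i p≤xs) ,
  (λ eq → inject≤-injective p≤xs p≤xs _ _ (lookup-injective u eq)) ,
  (λ i → ∈-lookup (inject≤ i p≤xs))

short-filter⇒∃¬ : ∀ {k} {P : Fin k → Set} (P? : Decidable P) →
  length (filter P? (allFin k)) < k → ∃ λ i → ¬ P i
short-filter⇒∃¬ {k} {P} P? short with all? P?
... | no ¬∀P = ¬∀⟶∃¬ k P P? ¬∀P
... | yes ∀P = contradiction k≤filtered (<⇒≱ short)
  where
  k≤filtered : k ≤ length (filter P? (allFin k))
  k≤filtered = subst (_≤ length (filter P? (allFin k))) (length-tabulate id)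
    (Unique⇒length≤ (allFin⁺ k) λ {i} _ → ∈-filter⁺ P? (∈-allFin i) (∀P i))

chain-crossing : ∀ {A : Set} {R : A → A → Set} {P Q : A → Set} →
  (∀ z → P z ⊎ Q z) → (∀ z → P z → ¬ Q z) →
  ∀ {x y} ws → Chain R (x ∷ ws) → last (x ∷ ws) ≡ just y → P x → Q y →
  ∃₂ λ a b → R a b × P a × Q b
chain-crossing part disj [] [-] refl px qy = ⊥-elim (disj _ px qy)
chain-crossing part disj {x} (w ∷ ws) (r ∷ ch) ends px qy with part w
... | inj₁ pw = chain-crossing part disj ws ch ends pw qy
... | inj₂ qw = x , w , r , px , qw

module Bipartition {V : Set} (V₁ V₂ : V → Set)
    (part : ∀ x → V₁ x ⊎ V₂ x) (disj : ∀ x → V₁ x → ¬ V₂ x) where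

  V₁? : Decidable V₁
  V₁? x with part x
  ... | inj₁ v₁ = yes v₁
  ... | inj₂ v₂ = no λ v₁ → disj x v₁ v₂

  V₂? : Decidable V₂
  V₂? x with part x
  ... | inj₁ v₁ = no (disj x v₁)
  ... | inj₂ v₂ = yes v₂

  Bichromatic : ∀ {L : Set} → (L → V) → Set
  Bichromatic line = (∃ λ l → V₁ (line l)) × (∃ λ l → V₂ (line l))

  bichromatic? : ∀ {k} (line : Fin k → V) → Dec (Bichromatic line)
  bichromatic? line = any? (V₁? ∘ line) ×-dec any? (V₂? ∘ line)

  bichromatic⇒crossing-edge : ∀ {k} (G : Graph k) → Connected G → (line : Fin k → V) →
    Bichromatic line → ∃₂ λ a b → Adj G a b × V₁ (line a) × V₂ (line b)
  bichromatic⇒crossing-edge G conn line ((a , a∈V₁) , (b , b∈V₂)) =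
    let (ws , walk , ends) = conn a b
    in chain-crossing (part ∘ line) (disj ∘ line) ws walk ends a∈V₁ b∈V₂

  record CrossEdgeAt {K : Set} (R : V → V → Set) (key : V → K) (k : K) : Set where
    field
      from to  : V
      adjacent : R from to
      from∈V₁  : V₁ from
      to∈V₂    : V₂ to
      key-from : key from ≡ k
      key-to   : key to ≡ k

  injective-keys⇒cross-matching : ∀ {K : Set} {p} (R : V → V → Set) (key : V → K)
    (sel : Fin p → K) → Injective _≡_ _≡_ sel → (∀ i → CrossEdgeAt R key (sel i)) →
    CrossMatching R V₁ V₂ p
  injective-keys⇒cross-matching R key sel sel-inj e =
    from ∘ e , to ∘ e , (λ i → adjacent (e i)) , (λ i → from∈V₁ (e i)) , (λ i → to∈V₂ (e i)) ,
    ends-injective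
    where
    open CrossEdgeAt
    ends-injective : Injective _≡_ _≡_ [ from ∘ e , to ∘ e ]
    ends-injective {inj₁ i} {inj₁ j} eq =
      cong inj₁ (sel-inj (trans (≡.sym (key-from (e i))) (trans (cong key eq) (key-from (e j)))))
    ends-injective {inj₂ i} {inj₂ j} eq =
      cong inj₂ (sel-inj (trans (≡.sym (key-to (e i))) (trans (cong key eq) (key-to (e j)))))
    ends-injective {inj₁ i} {inj₂ j} eq = ⊥-elim (disj _ (subst V₁ eq (from∈V₁ (e i))) (to∈V₂ (e j)))
    ends-injective {inj₂ i} {inj₁ j} eq = ⊥-elim (disj _ (from∈V₁ (e j)) (subst V₂ eq (to∈V₂ (e i))))

module Grid {A B : Set} (V₁ V₂ : A × B → Set)
    (part : ∀ x → V₁ x ⊎ V₂ x) (disj : ∀ x → V₁ x → ¬ V₂ x) where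

  open Bipartition V₁ V₂ part disj

  InBichromaticLines : A × B → Set
  InBichromaticLines (t , u) = Bichromatic (t ,_) × Bichromatic (_, u)

  other-colour⇒in-bichromatic-lines : ∀ {t* u* t u} → V₁ (t* , u*) →
    ¬ Bichromatic (t* ,_) → ¬ Bichromatic (_, u*) → V₂ (t , u) → InBichromaticLines (t , u)
  other-colour⇒in-bichromatic-lines {t*} {u*} {t} {u} v₁ mono-row mono-column v₂ =
    row , column
    where
    row : Bichromatic (t ,_)
    row with part (t , u*)
    ... | inj₁ w₁ = (u* , w₁) , (u , v₂)
    ... | inj₂ w₂ = ⊥-elim (mono-column ((t* , v₁) , (t , w₂)))
    column : Bichromatic (_, u)
    column with part (t* , u)
    ... | inj₁ w₁ = (t* , w₁) , (t , v₂)
    ... | inj₂ w₂ = ⊥-elim (mono-row ((u* , v₁) , (u , w₂)))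

module _ {A B : Set} (V₁ V₂ : A × B → Set)
    (part : ∀ x → V₁ x ⊎ V₂ x) (disj : ∀ x → V₁ x → ¬ V₂ x) where

  open Bipartition V₁ V₂ part disj
  open Grid V₁ V₂ part disj

  monochromatic-lines⇒colour-class-in-bichromatic-lines : ∀ {t* u*} →
    ¬ Bichromatic (t* ,_) → ¬ Bichromatic (_, u*) →
    (∀ {x} → V₁ x → InBichromaticLines x) ⊎ (∀ {x} → V₂ x → InBichromaticLines x)
  monochromatic-lines⇒colour-class-in-bichromatic-lines {t*} {u*} mono-row mono-column
    with part (t* , u*)
  ... | inj₁ v₁ = inj₂ (other-colour⇒in-bichromatic-lines v₁ mono-row mono-column)
  ... | inj₂ v₂ = inj₁ λ v₁ →
    let (row , column) = Grid.other-colour⇒in-bichromatic-lines V₂ V₁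
                           swap-part (λ x w₂ w₁ → disj x w₁ w₂) v₂
                           (mono-row ∘ swap) (mono-column ∘ swap) v₁
    in swap row , swap column
    where
    swap-part : ∀ x → V₂ x ⊎ V₁ x
    swap-part x = [ inj₂ , inj₁ ] (part x)

module TreeProduct {m n} (T : Graph m) (H : Graph n) (connT : Connected T) (connH : Connected H)
    (V₁ V₂ : Fin m × Fin n → Set)
    (part : ∀ x → V₁ x ⊎ V₂ x) (disj : ∀ x → V₁ x → ¬ V₂ x) where

  open Bipartition V₁ V₂ part disj
  open Grid V₁ V₂ part disj

  bichromaticRows : List (Fin m)
  bichromaticRows = filter (λ t → bichromatic? (t ,_)) (allFin m)

  bichromaticColumns : List (Fin n)
  bichromaticColumns = filter (λ u → bichromatic? (_, u)) (allFin n)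

  row-cross-edge : ∀ t → Bichromatic (t ,_) → CrossEdgeAt (TH-Adj T H) proj₁ t
  row-cross-edge t bi =
    let (a , b , ab , a∈V₁ , b∈V₂) = bichromatic⇒crossing-edge H connH (t ,_) bi
    in record { adjacent = inj₁ (refl , ab) ; from∈V₁ = a∈V₁ ; to∈V₂ = b∈V₂
              ; key-from = refl ; key-to = refl }

  column-cross-edge : ∀ u → Bichromatic (_, u) → CrossEdgeAt (TH-Adj T H) proj₂ u
  column-cross-edge u bi =
    let (a , b , ab , a∈V₁ , b∈V₂) = bichromatic⇒crossing-edge T connT (_, u) bi
    in record { adjacent = inj₂ (ab , refl) ; from∈V₁ = a∈V₁ ; to∈V₂ = b∈V₂
              ; key-from = refl ; key-to = refl }

  many-bichromatic-rows⇒cross-matching : ∀ {p} → p ≤ length bichromaticRows →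
    CrossMatching (TH-Adj T H) V₁ V₂ p
  many-bichromatic-rows⇒cross-matching p≤rows =
    let (sel , sel-inj , sel∈) = Unique⇒injective-selection (filter⁺ _ (allFin⁺ m)) p≤rows
    in injective-keys⇒cross-matching _ proj₁ sel sel-inj
         λ i → row-cross-edge (sel i) (proj₂ (∈-filter⁻ _ {xs = allFin m} (sel∈ i)))

  many-bichromatic-columns⇒cross-matching : ∀ {p} → p ≤ length bichromaticColumns →
    CrossMatching (TH-Adj T H) V₁ V₂ p
  many-bichromatic-columns⇒cross-matching p≤columns =
    let (sel , sel-inj , sel∈) = Unique⇒injective-selection (filter⁺ _ (allFin⁺ n)) p≤columns
    in injective-keys⇒cross-matching _ proj₂ sel sel-inj
         λ i → column-cross-edge (sel i) (proj₂ (∈-filter⁻ _ {xs = allFin n} (sel∈ i)))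

  in-bichromatic-lines⇒∈-product : ∀ {x} → InBichromaticLines x →
    x ∈ cartesianProduct bichromaticRows bichromaticColumns
  in-bichromatic-lines⇒∈-product {t , u} (row , column) =
    ∈-cartesianProduct⁺ (∈-filter⁺ _ (∈-allFin t) row) (∈-filter⁺ _ (∈-allFin u) column)

  few-bichromatic-lines⇒small-colour-class : ∀ {p} → p ≤ m → p ≤ n →
    length bichromaticRows < p → length bichromaticColumns < p →
    AtLeast V₁ (p * p) → AtLeast V₂ (p * p) → ⊥
  few-bichromatic-lines⇒small-colour-class {p} p≤m p≤n few-rows few-columns big₁ big₂ =
    let (t* , mono-row) = short-filter⇒∃¬ _ (<-≤-trans few-rows p≤m)
        (u* , mono-column) = short-filter⇒∃¬ _ (<-≤-trans few-columns p≤n)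
    in [ too-small big₁ , too-small big₂ ]
         (monochromatic-lines⇒colour-class-in-bichromatic-lines V₁ V₂ part disj
           {t*} {u*} mono-row mono-column)
    where
    product-small : length (cartesianProduct bichromaticRows bichromaticColumns) < p * p
    product-small = subst (_< p * p) (≡.sym (length-cartesianProduct bichromaticRows bichromaticColumns))
                      (*-mono-< few-rows few-columns)
    too-small : ∀ {C} → AtLeast C (p * p) → ¬ (∀ {x} → C x → InBichromaticLines x)
    too-small big C⊆lines =
      <-irrefl refl (≤-<-trans (AtLeast⇒≤length big (in-bichromatic-lines⇒∈-product ∘ C⊆lines)) product-small)

  cross-matching : ∀ {p} → p ≤ m → p ≤ n → AtLeast V₁ (p * p) → AtLeast V₂ (p * p) →
    CrossMatching (TH-Adj T H) V₁ V₂ p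
  cross-matching {p} p≤m p≤n big₁ big₂ with p ≤? length bichromaticRows | p ≤? length bichromaticColumns
  ... | yes many-rows | _ = many-bichromatic-rows⇒cross-matching many-rows
  ... | no _ | yes many-columns = many-bichromatic-columns⇒cross-matching many-columns
  ... | no few-rows | no few-columns = ⊥-elim (
    few-bichromatic-lines⇒small-colour-class p≤m p≤n (≰⇒> few-rows) (≰⇒> few-columns) big₁ big₂)

lemma10 : (p m n : ℕ) → 1 ≤ p →
    (T : Graph m) → IsTree T → p ≤ m →
    (H : Graph n) → Connected H → 2 * p ≤ n →
    (V₁ V₂ : Fin m × Fin n → Set) →
    (∀ x → V₁ x ⊎ V₂ x) → (∀ x → V₁ x → ¬ V₂ x) →
    AtLeast V₁ (p * p) → AtLeast V₂ (p * p) →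
    CrossMatching (TH-Adj T H) V₁ V₂ p
lemma10 p m n _ T (_ , connT , _) p≤m H connH 2p≤n V₁ V₂ part disj big₁ big₂ =
  TreeProduct.cross-matching T H connT connH V₁ V₂ part disj p≤m (≤-trans (m≤m+n p (p + 0)) 2p≤n)
    big₁ big₂
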